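{- Let $n,m$ be non-negative integers, not both zero. Then there exists an integer $a$ with $1\leq a<2^n3^m$ and $\gcd(a,2^n3^m)=1$ such that $K(a/2^n3^m)\leq 5$.
   Context: Every rational number $a/q\in(0,1)$ has a finite simple continued fraction expansion $a/q=[a_1,\ldots,a_r]=\cfrac{1}{a_1+\cfrac{1}{a_2+\cdots+\cfrac{1}{a_r}}}$ with positive integers $a_i$, taken with $a_r\geq 2$. Define $K(a/q)=\max(a_1,\ldots,a_r)$. -}

module Defs where

open import Data.Nat using (ℕ; zero; suc; _+_; _*_; _^_; _⊔_; NonZero)
open import Data.Nat.DivMod using (_/_; _%_)
open import Data.List using (List; []; _∷_; foldr)

-- Partial quotients of the continued fraction of a/q (0 < a < q) via the
-- Euclidean algorithm:  a/q = 1/(q/a + (q mod a)/a), so a₁ = ⌊q/a⌋ and the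
-- remaining quotients are those of (q mod a)/a.  The expansion stops when the
-- remainder is 0; this yields the canonical expansion with last quotient ≥ 2
-- (for 0 < a < q).  The fuel argument bounds the number of steps; fuel q
-- suffices since the numerator strictly decreases and starts below q.
cfGo : ℕ → ℕ → ℕ → List ℕ
cfGo zero    a       q = []
cfGo (suc f) zero    q = []
cfGo (suc f) (suc a) q = (q / suc a) ∷ cfGo f (q % suc a) (suc a)

cfQuotients : ℕ → ℕ → List ℕ
cfQuotients a q = cfGo q a q

K : ℕ → ℕ → ℕ
K a q = foldr _⊔_ 0 (cfQuotients a q)

-- The denominator of a palindromic expansion u w uᴿ is the quadratic form of the continued
-- fraction matrix of w evaluated at the first row of that of u.  For w = [c+2, c] and
-- w = [c+1, y, 1, c] this is 1 resp. y+1 times the square of the denominator of u ∷ʳ (c+1).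
-- So if q has an expansion with quotients in [1, 5] whose outer quotients lie in [2, 4],
-- mirroring it (with y = 1, 2, 5) gives such expansions of q², 2q², 3q² and 6q².  Halving the
-- exponents reduces every 2ⁿ3ᵐ with n ≥ 3 or m ≥ 2 to a finite table of explicit expansions;
-- the remaining denominators 2, 3, 4, 6, 12 are expanded by hand.

module Submission where

open import Defs
open import Data.Nat using (ℕ; zero; suc; _+_; _*_; _^_; _≤_; _<_; _⊔_; z≤n; s≤s; NonZero; >-nonZero; _≤?_)
open import Data.Nat.Properties
open import Data.Nat.DivMod using (_/_; _%_; m≡m%n+[m/n]*n; m%n<n; m/n<m; m/n≤m; /-monoˡ-≤; m*n/n≡m; m<n⇒m/n≡0; m<n⇒m%n≡m; +-distrib-/-∣ˡ; [m+kn]%n≡m%n)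
open import Data.Nat.Divisibility using (n∣m*n; ∣m+n∣m⇒∣n; ∣n⇒∣m*n)
open import Data.Nat.GCD using (gcd)
open import Data.Nat.Coprimality using (Coprime; coprime⇒gcd≡1; 1-coprimeTo)
import Data.Nat.Coprimality as Coprime
open import Data.Nat.Induction using (<-wellFounded)
open import Data.Nat.Tactic.RingSolver using (solve-∀)
open import Data.List using (List; []; _∷_; _++_; _∷ʳ_; reverse; foldr)
open import Data.List.Properties using (++-assoc; unfold-reverse; foldr-preservesᵇ)
open import Data.List.Relation.Unary.All using (All; []; _∷_; all?)
import Data.List.Relation.Unary.All as All
open import Data.List.Relation.Unary.All.Properties using (++⁺; ∷ʳ⁺)
open import Data.Product using (Σ; _×_; _,_; proj₁; proj₂)
open import Data.Sum using (_⊎_; inj₁; inj₂)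
import Data.Sum as Sum
open import Data.Empty using (⊥-elim)
open import Function using (_∘_)
open import Induction.WellFounded using (Acc; acc)
open import Relation.Binary.PropositionalEquality using (_≡_; refl; sym; trans; cong; cong₂; subst; module ≡-Reasoning)
open import Relation.Nullary using (¬_; Dec; yes; no)
open import Relation.Nullary.Decidable using (True; toWitness; _×-dec_; _⊎-dec_)

record Mat : Set where
  constructor mat
  field
    m₁₁ m₁₂ m₂₁ m₂₂ : ℕ
open Mat

mat≡ : ∀ {a b c d a′ b′ c′ d′} → a ≡ a′ → b ≡ b′ → c ≡ c′ → d ≡ d′ →
       mat a b c d ≡ mat a′ b′ c′ d′
mat≡ refl refl refl refl = refl

1ᴹ : Mat
1ᴹ = mat 1 0 0 1

infixl 7 _⊗_
_⊗_ : Mat → Mat → Mat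
mat a b c d ⊗ mat e f g h = mat (a * e + b * g) (a * f + b * h) (c * e + d * g) (c * f + d * h)

transpose : Mat → Mat
transpose (mat a b c d) = mat a c b d

infixr 5 _◃_
_◃_ : ℕ → Mat → Mat
x ◃ mat a b c d = mat (x * a + c) (x * b + d) a b

⊗-identityˡ : ∀ X → 1ᴹ ⊗ X ≡ X
⊗-identityˡ (mat e f g h) = mat≡ (unit e g) (unit f h) (unit′ e g) (unit′ f h)
  where
  unit : ∀ x y → 1 * x + 0 * y ≡ x
  unit = solve-∀
  unit′ : ∀ x y → 0 * x + 1 * y ≡ y
  unit′ = solve-∀

◃-⊗ : ∀ x X Y → x ◃ (X ⊗ Y) ≡ (x ◃ X) ⊗ Y
◃-⊗ x (mat a b c d) (mat e f g h) = mat≡ (assoc x a b c d e g) (assoc x a b c d f h) refl refl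
  where
  assoc : ∀ x a b c d e g → x * (a * e + b * g) + (c * e + d * g) ≡ (x * a + c) * e + (x * b + d) * g
  assoc = solve-∀

transpose-◃ : ∀ x X → transpose (x ◃ X) ≡ transpose X ⊗ mat x 1 1 0
transpose-◃ x (mat a b c d) = mat≡ (swap x a c) (keep a c) (swap x b d) (keep b d)
  where
  swap : ∀ x a c → x * a + c ≡ a * x + c * 1
  swap = solve-∀
  keep : ∀ a c → a ≡ a * 1 + c * 0
  keep = solve-∀

-- For w = [a₁, …, a_r] this is ∏ [[aᵢ, 1], [1, 0]], whose first column is (q, p) when w expands p/q.
cfMatrix : List ℕ → Mat
cfMatrix []      = 1ᴹ
cfMatrix (a ∷ w) = a ◃ cfMatrix w

den num : List ℕ → ℕ
den w = m₁₁ (cfMatrix w)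
num w = m₂₁ (cfMatrix w)

cfMatrix-++ : ∀ u v → cfMatrix (u ++ v) ≡ cfMatrix u ⊗ cfMatrix v
cfMatrix-++ []      v = sym (⊗-identityˡ (cfMatrix v))
cfMatrix-++ (a ∷ u) v = trans (cong (a ◃_) (cfMatrix-++ u v)) (◃-⊗ a (cfMatrix u) (cfMatrix v))

cfMatrix-singleton : ∀ a → cfMatrix (a ∷ []) ≡ mat a 1 1 0
cfMatrix-singleton a = mat≡ (trans (+-identityʳ _) (*-identityʳ a)) (cong (_+ 1) (*-zeroʳ a)) refl refl

cfMatrix-pair : ∀ a b → cfMatrix (a ∷ b ∷ []) ≡ mat (a * b + 1) a b 1
cfMatrix-pair a b = trans (cong (a ◃_) (cfMatrix-singleton b)) (mat≡ refl (trans (+-identityʳ _) (*-identityʳ a)) refl refl)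

cfMatrix-reverse : ∀ w → cfMatrix (reverse w) ≡ transpose (cfMatrix w)
cfMatrix-reverse []      = refl
cfMatrix-reverse (a ∷ w) = begin
  cfMatrix (reverse (a ∷ w))             ≡⟨ cong cfMatrix (unfold-reverse a w) ⟩
  cfMatrix (reverse w ∷ʳ a)              ≡⟨ cfMatrix-++ (reverse w) (a ∷ []) ⟩
  cfMatrix (reverse w) ⊗ cfMatrix (a ∷ []) ≡⟨ cong₂ _⊗_ (cfMatrix-reverse w) (cfMatrix-singleton a) ⟩
  transpose (cfMatrix w) ⊗ mat a 1 1 0   ≡⟨ sym (transpose-◃ a (cfMatrix w)) ⟩
  transpose (cfMatrix (a ∷ w))           ∎
  where open ≡-Reasoning

quadForm : Mat → ℕ → ℕ → ℕ
quadForm (mat n₁₁ n₁₂ n₂₁ n₂₂) a b = a * (n₁₁ * a + n₁₂ * b) + b * (n₂₁ * a + n₂₂ * b)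

den-∷ʳ : ∀ u k → den (u ∷ʳ k) ≡ den u * k + m₁₂ (cfMatrix u)
den-∷ʳ u k = begin
  den (u ∷ʳ k)                       ≡⟨ cong m₁₁ (cfMatrix-++ u (k ∷ [])) ⟩
  m₁₁ (cfMatrix u ⊗ cfMatrix (k ∷ [])) ≡⟨ cong (m₁₁ ∘ (cfMatrix u ⊗_)) (cfMatrix-singleton k) ⟩
  m₁₁ (cfMatrix u ⊗ mat k 1 1 0)     ≡⟨ cong (den u * k +_) (*-identityʳ _) ⟩
  den u * k + m₁₂ (cfMatrix u)       ∎
  where open ≡-Reasoning

den-palindrome : ∀ u w → den (u ++ w ++ reverse u) ≡ quadForm (cfMatrix w) (den u) (m₁₂ (cfMatrix u))
den-palindrome u w = begin
  den (u ++ w ++ reverse u)                                     ≡⟨ cong m₁₁ (cfMatrix-++ u (w ++ reverse u)) ⟩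
  m₁₁ (cfMatrix u ⊗ cfMatrix (w ++ reverse u))                  ≡⟨ cong (m₁₁ ∘ (cfMatrix u ⊗_)) (cfMatrix-++ w (reverse u)) ⟩
  m₁₁ (cfMatrix u ⊗ (cfMatrix w ⊗ cfMatrix (reverse u)))        ≡⟨ cong (λ R → m₁₁ (cfMatrix u ⊗ (cfMatrix w ⊗ R))) (cfMatrix-reverse u) ⟩
  m₁₁ (cfMatrix u ⊗ (cfMatrix w ⊗ transpose (cfMatrix u)))      ≡⟨ sandwich (cfMatrix u) (cfMatrix w) ⟩
  quadForm (cfMatrix w) (den u) (m₁₂ (cfMatrix u))             ∎
  where
  open ≡-Reasoning
  sandwich : ∀ X N → m₁₁ (X ⊗ (N ⊗ transpose X)) ≡ quadForm N (m₁₁ X) (m₁₂ X)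
  sandwich (mat _ _ _ _) (mat _ _ _ _) = refl

-- The quadratic form of N is x (k a + b)².
SquareForm : Mat → ℕ → ℕ → Set
SquareForm N x k = m₁₁ N ≡ x * (k * k) × m₁₂ N + m₂₁ N ≡ 2 * x * k × m₂₂ N ≡ x

quadForm-SquareForm : ∀ N {x k} → SquareForm N x k → ∀ a b → quadForm N a b ≡ x * ((a * k + b) * (a * k + b))
quadForm-SquareForm (mat n₁₁ n₁₂ n₂₁ n₂₂) {x} {k} (refl , cross , refl) a b = begin
  a * (x * (k * k) * a + n₁₂ * b) + b * (n₂₁ * a + x * b) ≡⟨ expand x k n₁₂ n₂₁ a b ⟩
  x * (k * k) * (a * a) + (n₁₂ + n₂₁) * (a * b) + x * (b * b) ≡⟨ cong (λ s → x * (k * k) * (a * a) + s * (a * b) + x * (b * b)) cross ⟩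
  x * (k * k) * (a * a) + 2 * x * k * (a * b) + x * (b * b) ≡⟨ square x k a b ⟩
  x * ((a * k + b) * (a * k + b))                              ∎
  where
  open ≡-Reasoning
  expand : ∀ x k n₁₂ n₂₁ a b → a * (x * (k * k) * a + n₁₂ * b) + b * (n₂₁ * a + x * b)
                               ≡ x * (k * k) * (a * a) + (n₁₂ + n₂₁) * (a * b) + x * (b * b)
  expand = solve-∀
  square : ∀ x k a b → x * (k * k) * (a * a) + 2 * x * k * (a * b) + x * (b * b) ≡ x * ((a * k + b) * (a * k + b))
  square = solve-∀

den-sandwich : ∀ u w {x k} → SquareForm (cfMatrix w) x k → den (u ++ w ++ reverse u) ≡ x * (den (u ∷ʳ k) * den (u ∷ʳ k))
den-sandwich u w {x} {k} sq = begin
  den (u ++ w ++ reverse u)                                ≡⟨ den-palindrome u w ⟩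
  quadForm (cfMatrix w) (den u) (m₁₂ (cfMatrix u))        ≡⟨ quadForm-SquareForm (cfMatrix w) sq (den u) _ ⟩
  x * ((den u * k + m₁₂ (cfMatrix u)) * (den u * k + m₁₂ (cfMatrix u))) ≡⟨ cong (λ d → x * (d * d)) (sym (den-∷ʳ u k)) ⟩
  x * (den (u ∷ʳ k) * den (u ∷ʳ k))                       ∎
  where open ≡-Reasoning

SquareForm-[2+c,c] : ∀ c → SquareForm (cfMatrix (2 + c ∷ c ∷ [])) 1 (1 + c)
SquareForm-[2+c,c] c = subst (λ N → SquareForm N 1 (1 + c)) (sym (cfMatrix-pair (2 + c) c)) (corner c , cross c , refl)
  where
  corner : ∀ c → (2 + c) * c + 1 ≡ 1 * ((1 + c) * (1 + c))
  corner = solve-∀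
  cross : ∀ c → (2 + c) + c ≡ 2 * 1 * (1 + c)
  cross = solve-∀

SquareForm-[1+c,y,1,c] : ∀ c y → SquareForm (cfMatrix (1 + c ∷ y ∷ 1 ∷ c ∷ [])) (1 + y) (1 + c)
SquareForm-[1+c,y,1,c] c y = subst (λ N → SquareForm N (1 + y) (1 + c)) (sym product) (corner c y , cross c y , last y)
  where
  product : cfMatrix (1 + c ∷ y ∷ 1 ∷ c ∷ []) ≡ mat ((1 + c) * y + 1) (1 + c) y 1 ⊗ mat (1 * c + 1) 1 c 1
  product = trans (cfMatrix-++ (1 + c ∷ y ∷ []) (1 ∷ c ∷ [])) (cong₂ _⊗_ (cfMatrix-pair (1 + c) y) (cfMatrix-pair 1 c))
  corner : ∀ c y → ((1 + c) * y + 1) * (1 * c + 1) + (1 + c) * c ≡ (1 + y) * ((1 + c) * (1 + c))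
  corner = solve-∀
  cross : ∀ c y → (((1 + c) * y + 1) * 1 + (1 + c) * 1) + (y * (1 * c + 1) + 1 * c) ≡ 2 * (1 + y) * (1 + c)
  cross = solve-∀
  last : ∀ y → y * 1 + 1 * 1 ≡ 1 + y
  last = solve-∀

data Canonical : List ℕ → Set where
  [_] : ∀ {a} → 2 ≤ a → Canonical (a ∷ [])
  _∷_ : ∀ {a w} → 1 ≤ a → Canonical w → Canonical (a ∷ w)

canonical-∷ʳ : ∀ {u l} → All (1 ≤_) u → 2 ≤ l → Canonical (u ∷ʳ l)
canonical-∷ʳ []         2≤l = [ 2≤l ]
canonical-∷ʳ (1≤a ∷ u⁺) 2≤l = 1≤a ∷ canonical-∷ʳ u⁺ 2≤l

num-den-coprime : ∀ w → Coprime (num w) (den w)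
num-den-coprime []      = Coprime.sym (1-coprimeTo 0)
num-den-coprime (a ∷ w) (d∣q , d∣aq+p) =
  num-den-coprime w (∣m+n∣m⇒∣n d∣aq+p (∣n⇒∣m*n a d∣q) , d∣q)

m<n*m+o : ∀ m {n o} → 1 ≤ n → 0 < o → m < n * m + o
m<n*m+o m {n} {o} 1≤n 0<o = <-≤-trans (m<m+n m 0<o) (+-monoˡ-≤ o (m≤n*m m n {{>-nonZero 1≤n}}))

den-singleton : ∀ a → den (a ∷ []) ≡ a
den-singleton a = trans (+-identityʳ _) (*-identityʳ a)

0<num<den : ∀ {w} → Canonical w → 0 < num w × num w < den w
0<num<den {a ∷ []} [ 2≤a ] = s≤s z≤n , subst (1 <_) (sym (den-singleton a)) 2≤a
0<num<den {a ∷ w} (1≤a ∷ c) with 0<num<den c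
... | 0<p , p<q = ≤-<-trans z≤n p<q , m<n*m+o (den w) 1≤a 0<p

cfGo-zero : ∀ f q → cfGo f 0 q ≡ []
cfGo-zero zero    q = refl
cfGo-zero (suc f) q = refl

cfGo-step : ∀ f a p q .{{_ : NonZero q}} → p < q → cfGo (suc f) q (a * q + p) ≡ a ∷ cfGo f p q
cfGo-step f a p q@(suc _) p<q = cong₂ _∷_ quotient (cong (λ r → cfGo f r q) remainder)
  where
  open ≡-Reasoning
  quotient : (a * q + p) / q ≡ a
  quotient = begin
    (a * q + p) / q     ≡⟨ +-distrib-/-∣ˡ p (n∣m*n a) ⟩
    a * q / q + p / q   ≡⟨ cong₂ _+_ (m*n/n≡m a q) (m<n⇒m/n≡0 p<q) ⟩
    a + 0               ≡⟨ +-identityʳ a ⟩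
    a                   ∎
  remainder : (a * q + p) % q ≡ p
  remainder = begin
    (a * q + p) % q     ≡⟨ cong (_% q) (+-comm (a * q) p) ⟩
    (p + a * q) % q     ≡⟨ [m+kn]%n≡m%n p a q ⟩
    p % q               ≡⟨ m<n⇒m%n≡m p<q ⟩
    p                   ∎

cfGo-num-den : ∀ {w} → Canonical w → ∀ f → den w ≤ f → cfGo f (num w) (den w) ≡ w
cfGo-num-den c zero den≤0 = ⊥-elim (<⇒≱ (≤-<-trans z≤n (proj₂ (0<num<den c))) den≤0)
cfGo-num-den {a ∷ []} [ _ ] (suc f) _ =
  trans (cfGo-step f a 0 1 (s≤s z≤n)) (cong (a ∷_) (cfGo-zero f 1))
cfGo-num-den {a ∷ w} (1≤a ∷ c) (suc f) den≤1+f =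
  trans (cfGo-step f a (num w) (den w) {{q≢0}} p<q) (cong (a ∷_) (cfGo-num-den c f den≤f))
  where
  p<q = proj₂ (0<num<den c)
  q≢0 = >-nonZero (≤-<-trans z≤n p<q)
  den≤f = ≤-pred (<-≤-trans (m<n*m+o (den w) 1≤a (proj₁ (0<num<den c))) den≤1+f)

Zaremba : ℕ → ℕ → Set
Zaremba k q = Σ ℕ (λ a → (1 ≤ a) × (a < q) × (gcd a q ≡ 1) × (K a q ≤ k))

zaremba-canonical : ∀ {k w} → Canonical w → All (_≤ k) w → Zaremba k (den w)
zaremba-canonical {k} {w} c w≤k =
  num w , 0<p , p<q , coprime⇒gcd≡1 (num-den-coprime w) ,
  subst (λ v → foldr _⊔_ 0 v ≤ k) (sym (cfGo-num-den c (den w) ≤-refl)) (foldr-preservesᵇ ⊔-lub z≤n w≤k)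
  where
  0<p = proj₁ (0<num<den c)
  p<q = proj₂ (0<num<den c)

_∈[_,_] : ℕ → ℕ → ℕ → Set
e ∈[ lo , hi ] = lo ≤ e × e ≤ hi

_∈[_,_]? : ∀ e lo hi → Dec (e ∈[ lo , hi ])
e ∈[ lo , hi ]? = lo ≤? e ×-dec e ≤? hi

zaremba-∷ʳ : ∀ {k u l} → All (_∈[ 1 , k ]) u → l ∈[ 2 , k ] → Zaremba k (den (u ∷ʳ l))
zaremba-∷ʳ u∈ (2≤l , l≤k) = zaremba-canonical (canonical-∷ʳ (All.map proj₁ u∈) 2≤l) (∷ʳ⁺ (All.map proj₂ u∈) l≤k)

zaremba-word : ∀ k u l → {True (all? (λ e → e ∈[ 1 , k ]?) u ×-dec l ∈[ 2 , k ]?)} → Zaremba k (den (u ∷ʳ l))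
zaremba-word k u l {ok} = zaremba-∷ʳ (proj₁ (toWitness ok)) (proj₂ (toWitness ok))

-- The outer quotients are kept in [2, 4] so that the middle words [c+2, c] and [c+1, y, 1, c]
-- built from the last one c+1 have all their entries in [1, 5].
record Framed (q : ℕ) : Set where
  constructor framed
  field
    {first last} : ℕ
    inner        : List ℕ
    first∈       : first ∈[ 2 , 4 ]
    inner∈       : All (_∈[ 1 , 5 ]) inner
    last∈        : last ∈[ 2 , 4 ]
    den-word     : den (first ∷ inner ∷ʳ last) ≡ q

framed-word : ∀ h u l → {True (h ∈[ 2 , 4 ]? ×-dec all? (λ e → e ∈[ 1 , 5 ]?) u ×-dec l ∈[ 2 , 4 ]?)} →
              Framed (den (h ∷ u ∷ʳ l))
framed-word h u l {ok} with toWitness ok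
... | h∈ , u∈ , l∈ = framed u h∈ u∈ l∈ refl

[2,4]⊆[1,5] : ∀ {e} → e ∈[ 2 , 4 ] → e ∈[ 1 , 5 ]
[2,4]⊆[1,5] (2≤e , e≤4) = ≤-trans (n≤1+n 1) 2≤e , ≤-trans e≤4 (n≤1+n 4)

framed⇒zaremba : ∀ {q} → Framed q → Zaremba 5 q
framed⇒zaremba (framed u h∈ u∈ (2≤l , l≤4) refl) = zaremba-∷ʳ ([2,4]⊆[1,5] h∈ ∷ u∈) (2≤l , ≤-trans l≤4 (n≤1+n 4))

reverse⁺ : ∀ {P : ℕ → Set} {u} → All P u → All P (reverse u)
reverse⁺ {u = []}    []        = []
reverse⁺ {P} {a ∷ u} (pa ∷ pu) = subst (All P) (sym (unfold-reverse a u)) (∷ʳ⁺ (reverse⁺ pu) pa)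

palindrome-∷ʳ : ∀ (h : ℕ) u w → h ∷ (u ++ w ++ reverse u) ∷ʳ h ≡ (h ∷ u) ++ w ++ reverse (h ∷ u)
palindrome-∷ʳ h u w = cong (h ∷_) (begin
  (u ++ w ++ reverse u) ∷ʳ h   ≡⟨ ++-assoc u (w ++ reverse u) _ ⟩
  u ++ (w ++ reverse u) ∷ʳ h   ≡⟨ cong (u ++_) (++-assoc w (reverse u) _) ⟩
  u ++ w ++ reverse u ∷ʳ h     ≡⟨ cong (λ v → u ++ w ++ v) (sym (unfold-reverse h u)) ⟩
  u ++ w ++ reverse (h ∷ u)    ∎)
  where open ≡-Reasoning

framed-sandwich : ∀ {q x} (F : Framed q) w → All (_∈[ 1 , 5 ]) w → SquareForm (cfMatrix w) x (Framed.last F) →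
                  Framed (x * (q * q))
framed-sandwich (framed {h} u h∈ u∈ _ refl) w w∈ sq =
  framed (u ++ w ++ reverse u) h∈ (++⁺ u∈ (++⁺ w∈ (reverse⁺ u∈))) h∈
         (trans (cong den (palindrome-∷ʳ h u w)) (den-sandwich (h ∷ u) w sq))

framed-square : ∀ {q} → Framed q → Framed (q * q)
framed-square F@(framed {last = suc c} _ _ _ (s≤s 1≤c , s≤s c≤3) _) =
  subst Framed (*-identityˡ _) (framed-sandwich F (2 + c ∷ c ∷ []) middle∈ (SquareForm-[2+c,c] c))
  where
  middle∈ : All (_∈[ 1 , 5 ]) (2 + c ∷ c ∷ [])
  middle∈ = (s≤s z≤n , s≤s (s≤s c≤3)) ∷ (1≤c , ≤-trans c≤3 (m≤m+n 3 2)) ∷ []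

framed-scale : ∀ {q y} → y ∈[ 1 , 5 ] → Framed q → Framed (suc y * (q * q))
framed-scale {y = y} y∈ F@(framed {last = suc c} _ _ _ (s≤s 1≤c , s≤s c≤3) _) =
  framed-sandwich F (1 + c ∷ y ∷ 1 ∷ c ∷ []) middle∈ (SquareForm-[1+c,y,1,c] c y)
  where
  middle∈ : All (_∈[ 1 , 5 ]) (1 + c ∷ y ∷ 1 ∷ c ∷ [])
  middle∈ = (s≤s z≤n , s≤s (≤-trans c≤3 (n≤1+n 3))) ∷ y∈ ∷ (s≤s z≤n , s≤s z≤n)
          ∷ (1≤c , ≤-trans c≤3 (m≤m+n 3 2)) ∷ []

framed-double : ∀ {q} i j → i ≤ 1 → j ≤ 1 → Framed q → Framed (2 ^ i * 3 ^ j * (q * q))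
framed-double 0 0 _ _ F = subst Framed (sym (*-identityˡ _)) (framed-square F)
framed-double 1 0 _ _ F = framed-scale (s≤s z≤n , s≤s z≤n) F
framed-double 0 1 _ _ F = framed-scale (s≤s z≤n , s≤s (s≤s z≤n)) F
framed-double 1 1 _ _ F = framed-scale (s≤s z≤n , ≤-refl) F
framed-double (suc (suc _)) _ (s≤s ()) _ _
framed-double _ (suc (suc _)) _ (s≤s ()) _

^-halves : ∀ b N → b ^ N ≡ b ^ (N % 2) * (b ^ (N / 2) * b ^ (N / 2))
^-halves b N = begin
  b ^ N                                    ≡⟨ cong (b ^_) (m≡m%n+[m/n]*n N 2) ⟩
  b ^ (N % 2 + N / 2 * 2)                  ≡⟨ cong (λ e → b ^ (N % 2 + e)) (double (N / 2)) ⟩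
  b ^ (N % 2 + (N / 2 + N / 2))            ≡⟨ ^-distribˡ-+-* b (N % 2) _ ⟩
  b ^ (N % 2) * b ^ (N / 2 + N / 2)        ≡⟨ cong (b ^ (N % 2) *_) (^-distribˡ-+-* b (N / 2) (N / 2)) ⟩
  b ^ (N % 2) * (b ^ (N / 2) * b ^ (N / 2)) ∎
  where
  open ≡-Reasoning
  double : ∀ n → n * 2 ≡ n + n
  double = solve-∀

2^3^-halves : ∀ N M → 2 ^ N * 3 ^ M ≡ 2 ^ (N % 2) * 3 ^ (M % 2) * ((2 ^ (N / 2) * 3 ^ (M / 2)) * (2 ^ (N / 2) * 3 ^ (M / 2)))
2^3^-halves N M = trans (cong₂ _*_ (^-halves 2 N) (^-halves 3 M)) (regroup (2 ^ (N % 2)) (3 ^ (M % 2)) (2 ^ (N / 2)) (3 ^ (M / 2)))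
  where
  regroup : ∀ i j a b → i * (a * a) * (j * (b * b)) ≡ i * j * ((a * b) * (a * b))
  regroup = solve-∀

Admissible : ℕ → ℕ → Set
Admissible N M = 3 ≤ N ⊎ 2 ≤ M

framed-table : ∀ N M → N ≤ 5 → M ≤ 3 → Admissible N M → Framed (2 ^ N * 3 ^ M)
framed-table 0 2 _ _ _ = framed-word 4 [] 2
framed-table 0 3 _ _ _ = framed-word 3 (2 ∷ 1 ∷ []) 2
framed-table 1 2 _ _ _ = framed-word 3 (1 ∷ 1 ∷ []) 2
framed-table 1 3 _ _ _ = framed-word 3 (5 ∷ 1 ∷ []) 2
framed-table 2 2 _ _ _ = framed-word 3 (3 ∷ 1 ∷ []) 2
framed-table 2 3 _ _ _ = framed-word 4 (1 ∷ 2 ∷ 3 ∷ []) 2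
framed-table 3 0 _ _ _ = framed-word 2 (1 ∷ []) 2
framed-table 3 1 _ _ _ = framed-word 4 (1 ∷ []) 4
framed-table 3 2 _ _ _ = framed-word 4 (4 ∷ []) 4
framed-table 3 3 _ _ _ = framed-word 4 (2 ∷ 2 ∷ 4 ∷ []) 2
framed-table 4 0 _ _ _ = framed-word 2 (3 ∷ []) 2
framed-table 4 1 _ _ _ = framed-word 4 (2 ∷ 1 ∷ []) 3
framed-table 4 2 _ _ _ = framed-word 4 (1 ∷ 1 ∷ 1 ∷ 4 ∷ []) 2
framed-table 4 3 _ _ _ = framed-word 3 (2 ∷ 5 ∷ 5 ∷ []) 2
framed-table 5 0 _ _ _ = framed-word 4 (1 ∷ 1 ∷ []) 3
framed-table 5 1 _ _ _ = framed-word 4 (5 ∷ 1 ∷ []) 3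
framed-table 5 2 _ _ _ = framed-word 4 (1 ∷ 2 ∷ 1 ∷ 1 ∷ 2 ∷ []) 3
framed-table 5 3 _ _ _ = framed-word 3 (5 ∷ 3 ∷ 5 ∷ []) 3
framed-table 0 0 _ _ (inj₁ ())
framed-table 0 0 _ _ (inj₂ ())
framed-table 0 1 _ _ (inj₁ ())
framed-table 0 1 _ _ (inj₂ (s≤s ()))
framed-table 1 0 _ _ (inj₁ (s≤s ()))
framed-table 1 0 _ _ (inj₂ ())
framed-table 1 1 _ _ (inj₁ (s≤s ()))
framed-table 1 1 _ _ (inj₂ (s≤s ()))
framed-table 2 0 _ _ (inj₁ (s≤s (s≤s ())))
framed-table 2 0 _ _ (inj₂ ())
framed-table 2 1 _ _ (inj₁ (s≤s (s≤s ())))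
framed-table 2 1 _ _ (inj₂ (s≤s ()))
framed-table (suc (suc (suc (suc (suc (suc _)))))) _ (s≤s (s≤s (s≤s (s≤s (s≤s ()))))) _ _
framed-table _ (suc (suc (suc (suc _)))) _ (s≤s (s≤s (s≤s ()))) _

Large : ℕ → ℕ → Set
Large N M = 6 ≤ N ⊎ 4 ≤ M

halves-admissible : ∀ {N M} → Large N M → Admissible (N / 2) (M / 2)
halves-admissible = Sum.map (/-monoˡ-≤ 2) (/-monoˡ-≤ 2)

halves-< : ∀ {N M} → Large N M → N / 2 + M / 2 < N + M
halves-< {N} {M} (inj₁ 6≤N) = +-mono-<-≤ (m/n<m N 2 {{>-nonZero (≤-trans (s≤s z≤n) 6≤N)}} ≤-refl) (m/n≤m M 2)
halves-< {N} {M} (inj₂ 4≤M) = +-mono-≤-< (m/n≤m N 2) (m/n<m M 2 {{>-nonZero (≤-trans (s≤s z≤n) 4≤M)}} ≤-refl)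

framed-2^3^-acc : ∀ N M → Acc _<_ (N + M) → Admissible N M → Framed (2 ^ N * 3 ^ M)
framed-2^3^-acc N M (acc smaller) adm with 6 ≤? N ⊎-dec 4 ≤? M
... | no small  = framed-table N M (≤-pred (≰⇒> (small ∘ inj₁))) (≤-pred (≰⇒> (small ∘ inj₂))) adm
... | yes large =
  subst Framed (sym (2^3^-halves N M))
    (framed-double (N % 2) (M % 2) (≤-pred (m%n<n N 2)) (≤-pred (m%n<n M 2))
      (framed-2^3^-acc (N / 2) (M / 2) (smaller (halves-< large)) (halves-admissible large)))

framed-2^3^ : ∀ N M → Admissible N M → Framed (2 ^ N * 3 ^ M)
framed-2^3^ N M = framed-2^3^-acc N M (<-wellFounded (N + M))

corollary1 : (n m : ℕ) → ¬ (n ≡ 0 × m ≡ 0) →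
    Σ ℕ (λ a → (1 ≤ a) × (a < 2 ^ n * 3 ^ m) × (gcd a (2 ^ n * 3 ^ m) ≡ 1)
      × (K a (2 ^ n * 3 ^ m) ≤ 5))
corollary1 0 0 n,m≢0 = ⊥-elim (n,m≢0 (refl , refl))
corollary1 1 0 _ = zaremba-word 5 [] 2
corollary1 0 1 _ = zaremba-word 5 [] 3
corollary1 2 0 _ = zaremba-word 5 [] 4
corollary1 1 1 _ = zaremba-word 5 (1 ∷ []) 5
corollary1 2 1 _ = zaremba-word 5 (2 ∷ 2 ∷ []) 2
corollary1 (suc (suc (suc n))) m _ = framed⇒zaremba (framed-2^3^ (3 + n) m (inj₁ (s≤s (s≤s (s≤s z≤n)))))
corollary1 n (suc (suc m)) _ = framed⇒zaremba (framed-2^3^ n (2 + m) (inj₂ (s≤s (s≤s z≤n))))
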